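{- Let $M$ be a closed term of the untyped $\lambda$-calculus and $m\ge 0$. The following are equivalent: (i) $M$ is of arity $m\rightarrow 1$; (ii) $(M\,\mathbf{I})^\bullet\circ\mathbf{B}^m=_{\beta\eta}M$; (iii) $M^\bullet\circ\mathbf{B}^{m+1}=_{\beta\eta}(\mathbf{B}\,M)\circ\mathbf{B}$.
   Context: Work in the untyped $\lambda$-calculus with $\beta\eta$-equality $=_{\beta\eta}$. Put $\mathbf{I}=\lambda f.f$, $\mathbf{B}=\lambda fxy.f\,(x\,y)$, and for a closed term $P$, $P^\bullet=\lambda f.f\,P$. For terms $M,N$ write $M\circ N=\mathbf{B}\,M\,N$. Let $\mathbf{B}^0=\mathbf{I}$ and $\mathbf{B}^{k+1}=\mathbf{B}\circ\mathbf{B}^k$ (the $k$-fold $\circ$-composite of $\mathbf{B}$). A closed term $M$ is of arity $m\rightarrow n$ if $M=_{\beta\eta}\lambda f x_1\dots x_m.f\,M_1\dots M_n$ for some terms $M_1,\dots,M_n$ in which $f$ does not occur free. -}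

module Defs where

open import Data.Nat using (ℕ; zero; suc)
open import Data.Fin using (Fin; zero; suc; fromℕ; inject₁)
open import Data.Vec using (Vec; []; _∷_; map)
open import Data.Product using (Σ)

-- Untyped λ-terms, well-scoped de Bruijn representation:
-- Term n = terms with free variables among var 0 … var (n-1).
-- var zero refers to the innermost enclosing binder.
infixl 7 _·_
data Term (n : ℕ) : Set where
  var : Fin n → Term n
  ƛ_  : Term (suc n) → Term n
  _·_ : Term n → Term n → Term n

ext : ∀ {m n} → (Fin m → Fin n) → Fin (suc m) → Fin (suc n)
ext ρ zero    = zero
ext ρ (suc i) = suc (ρ i)

rename : ∀ {m n} → (Fin m → Fin n) → Term m → Term n
rename ρ (var i) = var (ρ i)
rename ρ (ƛ t)   = ƛ rename (ext ρ) t
rename ρ (t · u) = rename ρ t · rename ρ u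

weaken : ∀ {n} → Term n → Term (suc n)
weaken = rename suc

exts : ∀ {m n} → (Fin m → Term n) → Fin (suc m) → Term (suc n)
exts σ zero    = var zero
exts σ (suc i) = weaken (σ i)

subst : ∀ {m n} → (Fin m → Term n) → Term m → Term n
subst σ (var i) = σ i
subst σ (ƛ t)   = ƛ subst (exts σ) t
subst σ (t · u) = subst σ t · subst σ u


sub1 : ∀ {n} → Term n → Fin (suc n) → Term n
sub1 u zero    = u
sub1 u (suc i) = var i

_[_] : ∀ {n} → Term (suc n) → Term n → Term n
t [ u ] = subst (sub1 u) t

infix 4 _=βη_
data _=βη_ {n : ℕ} : Term n → Term n → Set where
  β      : ∀ (t : Term (suc n)) (u : Term n) → (ƛ t) · u =βη t [ u ]
  η      : ∀ (t : Term n) → ƛ (weaken t · var zero) =βη t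
  refl   : ∀ {t} → t =βη t
  sym    : ∀ {t u} → t =βη u → u =βη t
  trans  : ∀ {t u v} → t =βη u → u =βη v → t =βη v
  app    : ∀ {t t′ u u′} → t =βη t′ → u =βη u′ → t · u =βη t′ · u′
  lam    : ∀ {t t′ : Term (suc n)} → t =βη t′ → ƛ t =βη ƛ t′

𝐈 : ∀ {n} → Term n
𝐈 = ƛ var zero

-- B = λ f x y . f (x y)
𝐁 : ∀ {n} → Term n
𝐁 = ƛ ƛ ƛ (var (suc (suc zero)) · (var (suc zero) · var zero))

_• : ∀ {n} → Term n → Term n
P • = ƛ (var zero · weaken P)

infixr 9 _∘_
_∘_ : ∀ {n} → Term n → Term n → Term n
M ∘ N = 𝐁 · M · N

𝐁^ : ∀ {n} → ℕ → Term n
𝐁^ zero    = 𝐈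
𝐁^ (suc k) = 𝐁 ∘ 𝐁^ k

-- λ-abstract all k free variables of a term, giving a closed term.
-- The outermost binder binds var (k-1), the innermost binds var 0.
closeLams : (k : ℕ) → Term k → Term 0
closeLams zero    t = t
closeLams (suc k) t = closeLams k (ƛ t)

apps : ∀ {k n} → Term k → Vec (Term k) n → Term k
apps h []       = h
apps h (N ∷ Ns) = apps (h · N) Ns

-- A closed term M has arity m → n if
--   M =βη λ f x₁ … xₘ . f M₁ … Mₙ  with f not free in the Mᵢ.
-- Under the m+1 binders, f is var m (outermost) and xₘ is var 0.
-- The Mᵢ are taken in the scope of x₁ … xₘ only (Term m), then
-- embedded into the scope f, x₁ … xₘ without using f (inject₁).
HasArity : ℕ → ℕ → Term 0 → Set
HasArity m n M =
  Σ (Vec (Term m) n) λ Ms →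
    M =βη closeLams (suc m) (apps (var (fromℕ m)) (map (rename inject₁) Ms))

-- Applied to f x₁ … xₘ, the term (M 𝐈)• ∘ 𝐁^m reduces to f (M 𝐈 x₁ … xₘ); applied to g y x₁ … xₘ,
-- M• ∘ 𝐁^(m+1) reduces to g (M y x₁ … xₘ) and (𝐁 M) ∘ 𝐁 to M (𝐁 g y) x₁ … xₘ. By η, (ii) thus says
-- M f x⃗ = f (M 𝐈 x⃗), which is arity m → 1 with body M 𝐈 x⃗. If M f x⃗ = f N, both sides of (iii)
-- become g (y N). Conversely, taking y := 𝐈 in (iii) and using 𝐁 f 𝐈 = f gives (ii).

module Submission where

open import Data.Nat using (ℕ; zero; suc)
open import Data.Fin using (Fin; zero; suc; fromℕ; inject₁)
open import Data.Vec using ([]; _∷_)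
open import Data.Vec.Functional using (Vector; head; tail; init; last)
open import Data.Product using (_×_; _,_)
open import Function.Bundles using (_⇔_; mk⇔)
open import Level using (0ℓ)
open import Relation.Binary.Bundles using (Setoid)
open import Relation.Binary.PropositionalEquality as ≡ using (_≡_; _≗_)
import Relation.Binary.Reasoning.Setoid as SetoidReasoning
open import Defs

private
  variable
    k m n : ℕ

βη-setoid : ℕ → Setoid 0ℓ 0ℓ
βη-setoid n = record
  { Carrier       = Term n
  ; _≈_           = _=βη_
  ; isEquivalence = record { refl = refl ; sym = sym ; trans = trans }
  }

module βη-Reasoning {n : ℕ} = SetoidReasoning (βη-setoid n)

≡⇒=βη : {t u : Term n} → t ≡ u → t =βη u
≡⇒=βη ≡.refl = refl

ext-cong : {ρ ρ′ : Fin m → Fin n} → ρ ≗ ρ′ → ext ρ ≗ ext ρ′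
ext-cong eq zero    = ≡.refl
ext-cong eq (suc i) = ≡.cong suc (eq i)

rename-cong : {ρ ρ′ : Fin m → Fin n} → ρ ≗ ρ′ → rename ρ ≗ rename ρ′
rename-cong eq (var i) = ≡.cong var (eq i)
rename-cong eq (ƛ t)   = ≡.cong ƛ_ (rename-cong (ext-cong eq) t)
rename-cong eq (t · u) = ≡.cong₂ _·_ (rename-cong eq t) (rename-cong eq u)

exts-cong : {σ σ′ : Fin m → Term n} → σ ≗ σ′ → exts σ ≗ exts σ′
exts-cong eq zero    = ≡.refl
exts-cong eq (suc i) = ≡.cong weaken (eq i)

subst-cong : {σ σ′ : Fin m → Term n} → σ ≗ σ′ → subst σ ≗ subst σ′
subst-cong eq (var i) = eq i
subst-cong eq (ƛ t)   = ≡.cong ƛ_ (subst-cong (exts-cong eq) t)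
subst-cong eq (t · u) = ≡.cong₂ _·_ (subst-cong eq t) (subst-cong eq u)

rename-rename : (ρ : Fin m → Fin n) (ρ′ : Fin k → Fin m) (t : Term k) →
                rename ρ (rename ρ′ t) ≡ rename (λ i → ρ (ρ′ i)) t
rename-rename ρ ρ′ (var i) = ≡.refl
rename-rename ρ ρ′ (ƛ t)   = ≡.cong ƛ_ (≡.trans (rename-rename (ext ρ) (ext ρ′) t)
  (rename-cong (λ { zero → ≡.refl ; (suc i) → ≡.refl }) t))
rename-rename ρ ρ′ (t · u) = ≡.cong₂ _·_ (rename-rename ρ ρ′ t) (rename-rename ρ ρ′ u)

subst-rename : (σ : Fin m → Term n) (ρ : Fin k → Fin m) (t : Term k) →
               subst σ (rename ρ t) ≡ subst (λ i → σ (ρ i)) t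
subst-rename σ ρ (var i) = ≡.refl
subst-rename σ ρ (ƛ t)   = ≡.cong ƛ_ (≡.trans (subst-rename (exts σ) (ext ρ) t)
  (subst-cong (λ { zero → ≡.refl ; (suc i) → ≡.refl }) t))
subst-rename σ ρ (t · u) = ≡.cong₂ _·_ (subst-rename σ ρ t) (subst-rename σ ρ u)

rename-subst : (ρ : Fin m → Fin n) (σ : Fin k → Term m) (t : Term k) →
               rename ρ (subst σ t) ≡ subst (λ i → rename ρ (σ i)) t
rename-subst ρ σ (var i) = ≡.refl
rename-subst ρ σ (ƛ t)   = ≡.cong ƛ_ (≡.trans (rename-subst (ext ρ) (exts σ) t)
  (subst-cong (λ { zero    → ≡.refl
                 ; (suc i) → ≡.trans (rename-rename (ext ρ) suc (σ i))
                                     (≡.sym (rename-rename suc ρ (σ i))) }) t))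
rename-subst ρ σ (t · u) = ≡.cong₂ _·_ (rename-subst ρ σ t) (rename-subst ρ σ u)

subst-exts-weaken : (σ : Fin m → Term n) (t : Term m) →
                    subst (exts σ) (weaken t) ≡ weaken (subst σ t)
subst-exts-weaken σ t = ≡.trans (subst-rename (exts σ) suc t) (≡.sym (rename-subst suc σ t))

subst-subst : (σ : Fin m → Term n) (τ : Fin k → Term m) (t : Term k) →
              subst σ (subst τ t) ≡ subst (λ i → subst σ (τ i)) t
subst-subst σ τ (var i) = ≡.refl
subst-subst σ τ (ƛ t)   = ≡.cong ƛ_ (≡.trans (subst-subst (exts σ) (exts τ) t)
  (subst-cong (λ { zero → ≡.refl ; (suc i) → subst-exts-weaken σ (τ i) }) t))
subst-subst σ τ (t · u) = ≡.cong₂ _·_ (subst-subst σ τ t) (subst-subst σ τ u)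

subst-var : (t : Term n) → subst var t ≡ t
subst-var (var i) = ≡.refl
subst-var (ƛ t)   = ≡.cong ƛ_ (≡.trans (subst-cong (λ { zero → ≡.refl ; (suc i) → ≡.refl }) t)
                                       (subst-var t))
subst-var (t · u) = ≡.cong₂ _·_ (subst-var t) (subst-var u)

weaken-[] : (t u : Term n) → weaken t [ u ] ≡ t
weaken-[] t u = ≡.trans (subst-rename (sub1 u) suc t) (subst-var t)

subst-[] : (σ : Fin m → Term n) (t : Term (suc m)) (u : Term m) →
           subst σ (t [ u ]) ≡ subst (exts σ) t [ subst σ u ]
subst-[] σ t u = ≡.trans (subst-subst σ (sub1 u) t) (≡.trans
  (subst-cong (λ { zero → ≡.refl ; (suc i) → ≡.sym (weaken-[] (σ i) (subst σ u)) }) t)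
  (≡.sym (subst-subst (sub1 (subst σ u)) (exts σ) t)))

subst-βη : (σ : Fin m → Term n) {t u : Term m} → t =βη u → subst σ t =βη subst σ u
subst-βη σ (β t u)     = trans (β _ _) (≡⇒=βη (≡.sym (subst-[] σ t u)))
subst-βη σ (η t)       = trans (lam (app (≡⇒=βη (subst-exts-weaken σ t)) refl)) (η _)
subst-βη σ refl        = refl
subst-βη σ (sym p)     = sym (subst-βη σ p)
subst-βη σ (trans p q) = trans (subst-βη σ p) (subst-βη σ q)
subst-βη σ (app p q)   = app (subst-βη σ p) (subst-βη σ q)
subst-βη σ (lam p)     = lam (subst-βη (exts σ) p)

lift : Term 0 → Term n
lift = subst (λ ())

subst-closed : (σ : Fin 0 → Term n) (t : Term 0) → subst σ t ≡ lift t
subst-closed σ = subst-cong (λ ())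

rename-lift : (ρ : Fin m → Fin n) (t : Term 0) → rename ρ (lift t) ≡ lift t
rename-lift ρ t = ≡.trans (rename-subst ρ (λ ()) t) (subst-closed _ t)

lift-βη : {t u : Term 0} → t =βη u → lift {n} t =βη lift u
lift-βη = subst-βη (λ ())

-- appsᶠ h k ρ = h (ρ (k-1)) … (ρ 0): the first argument is last ρ, matching the binder order of closeLams.
appsᶠ : Term n → (k : ℕ) → Vector (Term n) k → Term n
appsᶠ h zero    ρ = h
appsᶠ h (suc k) ρ = appsᶠ h k (tail ρ) · head ρ

appsᶠ-congˡ : {h h′ : Term n} (ρ : Vector (Term n) k) → h =βη h′ → appsᶠ h k ρ =βη appsᶠ h′ k ρ
appsᶠ-congˡ {k = zero}  ρ p = p
appsᶠ-congˡ {k = suc k} ρ p = app (appsᶠ-congˡ (tail ρ) p) refl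

appsᶠ-init-last : (h : Term n) (ρ : Vector (Term n) (suc k)) →
                  appsᶠ h (suc k) ρ ≡ appsᶠ (h · last ρ) k (init ρ)
appsᶠ-init-last {k = zero}  h ρ = ≡.refl
appsᶠ-init-last {k = suc k} h ρ = ≡.cong (_· head ρ) (appsᶠ-init-last h (tail ρ))

rename-appsᶠ : (ρ : Fin m → Fin n) (h : Term m) (σ : Vector (Term m) k) →
               rename ρ (appsᶠ h k σ) ≡ appsᶠ (rename ρ h) k (λ i → rename ρ (σ i))
rename-appsᶠ {k = zero}  ρ h σ = ≡.refl
rename-appsᶠ {k = suc k} ρ h σ = ≡.cong (_· rename ρ (head σ)) (rename-appsᶠ ρ h (tail σ))

_∷ʳ_ : {A : Set} → Vector A k → A → Vector A (suc k)
_∷ʳ_ {k = zero}  xs x _       = x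
_∷ʳ_ {k = suc k} xs x zero    = head xs
_∷ʳ_ {k = suc k} xs x (suc i) = (tail xs ∷ʳ x) i

last-∷ʳ : {A : Set} (xs : Vector A k) (x : A) → last (xs ∷ʳ x) ≡ x
last-∷ʳ {k = zero}  xs x = ≡.refl
last-∷ʳ {k = suc k} xs x = last-∷ʳ (tail xs) x

init-∷ʳ : {A : Set} (xs : Vector A k) (x : A) → init (xs ∷ʳ x) ≗ xs
init-∷ʳ {k = suc k} xs x zero    = ≡.refl
init-∷ʳ {k = suc k} xs x (suc i) = init-∷ʳ (tail xs) x i

appsᶠ-∷ʳ : (h : Term n) (σ : Vector (Term n) k) (x : Term n) →
           appsᶠ h (suc k) (σ ∷ʳ x) ≡ appsᶠ (h · x) k σ
appsᶠ-∷ʳ {k = zero}  h σ x = ≡.refl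
appsᶠ-∷ʳ {k = suc k} h σ x = ≡.cong (_· head σ) (appsᶠ-∷ʳ h (tail σ) x)

closeLams-cong : (k : ℕ) {t u : Term k} → t =βη u → closeLams k t =βη closeLams k u
closeLams-cong zero    p = p
closeLams-cong (suc k) p = closeLams-cong k (lam p)

appsᶠ-closeLams : (k : ℕ) (t : Term k) (ρ : Vector (Term n) k) →
                  appsᶠ (lift (closeLams k t)) k ρ =βη subst ρ t
appsᶠ-closeLams zero    t ρ = ≡⇒=βη (≡.sym (subst-closed ρ t))
appsᶠ-closeLams (suc k) t ρ = begin
  appsᶠ (lift (closeLams k (ƛ t))) k (tail ρ) · head ρ ≈⟨ app (appsᶠ-closeLams k (ƛ t) (tail ρ)) refl ⟩
  (ƛ subst (exts (tail ρ)) t) · head ρ                 ≈⟨ β _ _ ⟩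
  subst (exts (tail ρ)) t [ head ρ ]                   ≡⟨ subst-subst (sub1 (head ρ)) (exts (tail ρ)) t ⟩
  subst (λ i → exts (tail ρ) i [ head ρ ]) t           ≡⟨ subst-cong exts-[] t ⟩
  subst ρ t                                            ∎
  where
  open βη-Reasoning
  exts-[] : (λ i → exts (tail ρ) i [ head ρ ]) ≗ ρ
  exts-[] zero    = ≡.refl
  exts-[] (suc i) = weaken-[] (ρ (suc i)) (head ρ)

closeLams-appsᶠ : (k : ℕ) (A : Term 0) → A =βη closeLams k (appsᶠ (lift A) k var)
closeLams-appsᶠ zero    A = ≡⇒=βη (≡.trans (≡.sym (subst-var A)) (subst-closed var A))
closeLams-appsᶠ (suc k) A =
  trans (closeLams-appsᶠ k A) (closeLams-cong k (sym (trans (lam (app weakened refl)) (η _))))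
  where
  weakened : appsᶠ (lift A) k (λ i → var (suc i)) =βη weaken (appsᶠ (lift A) k var)
  weakened = ≡⇒=βη (≡.sym (≡.trans (rename-appsᶠ suc (lift A) var)
                                   (≡.cong (λ h → appsᶠ h k (λ i → var (suc i))) (rename-lift suc A))))

βη-ext : (k : ℕ) {A B : Term 0} → appsᶠ (lift A) k var =βη appsᶠ (lift B) k var → A =βη B
βη-ext k {A} {B} p = trans (closeLams-appsᶠ k A) (trans (closeLams-cong k p) (sym (closeLams-appsᶠ k B)))

𝐈-β : (t : Term n) → 𝐈 · t =βη t
𝐈-β t = β (var zero) t

𝐁-β₂ : (f x : Term n) → 𝐁 · f · x =βη ƛ (weaken f · (weaken x · var zero))
𝐁-β₂ f x = trans (app (β _ f) refl) (trans (β _ x) (lam (app (≡⇒=βη f-weakened) refl)))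
  where
  f-weakened : subst (exts (sub1 x)) (weaken (weaken f)) ≡ weaken f
  f-weakened = ≡.trans (subst-exts-weaken (sub1 x) (weaken f)) (≡.cong weaken (weaken-[] f x))

𝐁-β : (f x y : Term n) → 𝐁 · f · x · y =βη f · (x · y)
𝐁-β f x y = trans (app (𝐁-β₂ f x) refl)
  (trans (β _ y) (≡⇒=βη (≡.cong₂ (λ f′ x′ → f′ · (x′ · y)) (weaken-[] f y) (weaken-[] x y))))

𝐁-𝐈 : (f : Term n) → 𝐁 · f · 𝐈 =βη f
𝐁-𝐈 f = trans (𝐁-β₂ f 𝐈) (trans (lam (app refl (𝐈-β (var zero)))) (η f))

•-β : (P g : Term n) → P • · g =βη g · P
•-β P g = trans (β _ g) (≡⇒=βη (≡.cong (g ·_) (weaken-[] P g)))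

•∘-β : (P Q g : Term n) → (P • ∘ Q) · g =βη Q · g · P
•∘-β P Q g = trans (𝐁-β (P •) Q g) (•-β P (Q · g))

𝐁^-suc-β : (k : ℕ) (g x y : Term n) → 𝐁^ (suc k) · g · x · y =βη 𝐁^ k · g · (x · y)
𝐁^-suc-β k g x y = trans (app (app (𝐁-β 𝐁 (𝐁^ k) g) refl) refl) (𝐁-β (𝐁^ k · g) x y)

𝐁^-appsᶠ : (k : ℕ) (g x : Term n) (ρ : Vector (Term n) k) →
           appsᶠ (𝐁^ k · g · x) k ρ =βη g · appsᶠ x k ρ
𝐁^-appsᶠ zero    g x ρ = app (𝐈-β g) refl
𝐁^-appsᶠ (suc k) g x ρ = begin
  appsᶠ (𝐁^ (suc k) · g · x) (suc k) ρ           ≡⟨ appsᶠ-init-last _ ρ ⟩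
  appsᶠ (𝐁^ (suc k) · g · x · last ρ) k (init ρ) ≈⟨ appsᶠ-congˡ (init ρ) (𝐁^-suc-β k g x (last ρ)) ⟩
  appsᶠ (𝐁^ k · g · (x · last ρ)) k (init ρ)     ≈⟨ 𝐁^-appsᶠ k g (x · last ρ) (init ρ) ⟩
  g · appsᶠ (x · last ρ) k (init ρ)              ≡⟨ ≡.cong (g ·_) (appsᶠ-init-last x ρ) ⟨
  g · appsᶠ x (suc k) ρ                          ∎
  where open βη-Reasoning

•∘𝐁^-appsᶠ : (k : ℕ) (P g : Term n) (ρ : Vector (Term n) k) →
             appsᶠ ((P • ∘ 𝐁^ k) · g) k ρ =βη g · appsᶠ P k ρ
•∘𝐁^-appsᶠ k P g ρ = trans (appsᶠ-congˡ ρ (•∘-β P (𝐁^ k) g)) (𝐁^-appsᶠ k g P ρ)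

•∘𝐁^-suc-appsᶠ : (k : ℕ) (P g y : Term n) (σ : Vector (Term n) k) →
                 appsᶠ ((P • ∘ 𝐁^ (suc k)) · g · y) k σ =βη g · appsᶠ (P · y) k σ
•∘𝐁^-suc-appsᶠ k P g y σ = begin
  appsᶠ ((P • ∘ 𝐁^ (suc k)) · g · y) k σ          ≡⟨ appsᶠ-∷ʳ _ σ y ⟨
  appsᶠ ((P • ∘ 𝐁^ (suc k)) · g) (suc k) (σ ∷ʳ y) ≈⟨ •∘𝐁^-appsᶠ (suc k) P g (σ ∷ʳ y) ⟩
  g · appsᶠ P (suc k) (σ ∷ʳ y)                    ≡⟨ ≡.cong (g ·_) (appsᶠ-∷ʳ P σ y) ⟩
  g · appsᶠ (P · y) k σ                           ∎
  where open βη-Reasoning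

𝐁∘𝐁-β : (P g y : Term n) → ((𝐁 · P) ∘ 𝐁) · g · y =βη P · (𝐁 · g · y)
𝐁∘𝐁-β P g y = trans (app (𝐁-β (𝐁 · P) 𝐁 g) refl) (𝐁-β P (𝐁 · g) y)

subst-• : (σ : Fin m → Term n) (P : Term m) → subst σ (P •) ≡ subst σ P •
subst-• σ P = ≡.cong (λ t → ƛ (var zero · t)) (subst-exts-weaken σ P)

subst-𝐁^ : (σ : Fin m → Term n) (k : ℕ) → subst σ (𝐁^ k) ≡ 𝐁^ k
subst-𝐁^ σ zero    = ≡.refl
subst-𝐁^ σ (suc k) = ≡.cong (𝐁 · 𝐁 ·_) (subst-𝐁^ σ k)

subst-•∘𝐁^ : (σ : Fin m → Term n) (P : Term m) (k : ℕ) → subst σ (P • ∘ 𝐁^ k) ≡ subst σ P • ∘ 𝐁^ k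
subst-•∘𝐁^ σ P k = ≡.cong₂ (λ a b → 𝐁 · a · b) (subst-• σ P) (subst-𝐁^ σ k)

hasArity⇒appsᶠ : {M : Term 0} {N : Term m} → M =βη closeLams (suc m) (var (fromℕ m) · rename inject₁ N) →
                 (h : Term n) (σ : Vector (Term n) m) → appsᶠ (lift M · h) m σ =βη h · subst σ N
hasArity⇒appsᶠ {m} {M = M} {N = N} p h σ = begin
  appsᶠ (lift M · h) m σ                                 ≡⟨ appsᶠ-∷ʳ (lift M) σ h ⟨
  appsᶠ (lift M) (suc m) (σ ∷ʳ h)                        ≈⟨ appsᶠ-congˡ (σ ∷ʳ h) (lift-βη p) ⟩
  appsᶠ (lift (closeLams (suc m) body)) (suc m) (σ ∷ʳ h) ≈⟨ appsᶠ-closeLams (suc m) body (σ ∷ʳ h) ⟩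
  last (σ ∷ʳ h) · subst (σ ∷ʳ h) (rename inject₁ N)      ≡⟨ ≡.cong₂ _·_ (last-∷ʳ σ h) N-restricted ⟩
  h · subst σ N                                          ∎
  where
  open βη-Reasoning
  body : Term (suc m)
  body = var (fromℕ m) · rename inject₁ N
  N-restricted : subst (σ ∷ʳ h) (rename inject₁ N) ≡ subst σ N
  N-restricted = ≡.trans (subst-rename (σ ∷ʳ h) inject₁ N) (subst-cong (init-∷ʳ σ h) N)

appsᶠ⇒hasArity : {M : Term 0} (N : Term m) →
                 appsᶠ (lift M · var (fromℕ m)) m (init var) =βη var (fromℕ m) · rename inject₁ N →
                 HasArity m 1 M
appsᶠ⇒hasArity {m} {M} N p = N ∷ [] , trans (closeLams-appsᶠ (suc m) M)
  (closeLams-cong (suc m) (trans (≡⇒=βη (appsᶠ-init-last (lift M) var)) p))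

module _ (M : Term 0) (m : ℕ) where

  private
    f : Term (suc m)
    f = var (fromℕ m)

    xs : Vector (Term (suc m)) m
    xs = init var

    βη-ext-head : {A B : Term 0} → appsᶠ (lift A · f) m xs =βη appsᶠ (lift B · f) m xs → A =βη B
    βη-ext-head {A} {B} p = βη-ext (suc m)
      (trans (≡⇒=βη (appsᶠ-init-last (lift A) var)) (trans p (≡⇒=βη (≡.sym (appsᶠ-init-last (lift B) var)))))

    L₂-appsᶠ : (h : Term n) (σ : Vector (Term n) m) →
               appsᶠ (lift ((M · 𝐈) • ∘ 𝐁^ m) · h) m σ =βη h · appsᶠ (lift M · 𝐈) m σ
    L₂-appsᶠ h σ = trans (appsᶠ-congˡ σ (app (≡⇒=βη (subst-•∘𝐁^ _ (M · 𝐈) m)) refl))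
                         (•∘𝐁^-appsᶠ m (lift M · 𝐈) h σ)

    L₃-appsᶠ : (g y : Term n) (σ : Vector (Term n) m) →
               appsᶠ (lift (M • ∘ 𝐁^ (suc m)) · g · y) m σ =βη g · appsᶠ (lift M · y) m σ
    L₃-appsᶠ g y σ = trans (appsᶠ-congˡ σ (app (app (≡⇒=βη (subst-•∘𝐁^ _ M (suc m))) refl) refl))
                           (•∘𝐁^-suc-appsᶠ m (lift M) g y σ)

  i⇒ii : HasArity m 1 M → (M · 𝐈) • ∘ 𝐁^ m =βη M
  i⇒ii (N ∷ [] , p) = βη-ext-head (begin
    appsᶠ (lift ((M · 𝐈) • ∘ 𝐁^ m) · f) m xs ≈⟨ L₂-appsᶠ f xs ⟩
    f · appsᶠ (lift M · 𝐈) m xs              ≈⟨ app refl (hasArity⇒appsᶠ p 𝐈 xs) ⟩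
    f · (𝐈 · subst xs N)                     ≈⟨ app refl (𝐈-β _) ⟩
    f · subst xs N                           ≈⟨ hasArity⇒appsᶠ p f xs ⟨
    appsᶠ (lift M · f) m xs                  ∎)
    where open βη-Reasoning

  ii⇒i : (M · 𝐈) • ∘ 𝐁^ m =βη M → HasArity m 1 M
  ii⇒i H = appsᶠ⇒hasArity N (begin
    appsᶠ (lift M · f) m xs                  ≈⟨ appsᶠ-congˡ xs (app (lift-βη H) refl) ⟨
    appsᶠ (lift ((M · 𝐈) • ∘ 𝐁^ m) · f) m xs ≈⟨ L₂-appsᶠ f xs ⟩
    f · appsᶠ (lift M · 𝐈) m xs              ≡⟨ ≡.cong (f ·_) N-weakened ⟨
    f · rename inject₁ N                     ∎)
    where
    open βη-Reasoning
    N : Term m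
    N = appsᶠ (lift M · 𝐈) m var
    N-weakened : rename inject₁ N ≡ appsᶠ (lift M · 𝐈) m xs
    N-weakened = ≡.trans (rename-appsᶠ inject₁ (lift M · 𝐈) var)
                         (≡.cong (λ h → appsᶠ (h · 𝐈) m xs) (rename-lift inject₁ M))

  iii⇒ii : M • ∘ 𝐁^ (suc m) =βη (𝐁 · M) ∘ 𝐁 → (M · 𝐈) • ∘ 𝐁^ m =βη M
  iii⇒ii H = βη-ext-head (begin
    appsᶠ (lift ((M · 𝐈) • ∘ 𝐁^ m) · f) m xs     ≈⟨ L₂-appsᶠ f xs ⟩
    f · appsᶠ (lift M · 𝐈) m xs                  ≈⟨ L₃-appsᶠ f 𝐈 xs ⟨
    appsᶠ (lift (M • ∘ 𝐁^ (suc m)) · f · 𝐈) m xs ≈⟨ appsᶠ-congˡ xs (app (app (lift-βη H) refl) refl) ⟩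
    appsᶠ (lift ((𝐁 · M) ∘ 𝐁) · f · 𝐈) m xs      ≈⟨ appsᶠ-congˡ xs (𝐁∘𝐁-β (lift M) f 𝐈) ⟩
    appsᶠ (lift M · (𝐁 · f · 𝐈)) m xs            ≈⟨ appsᶠ-congˡ xs (app refl (𝐁-𝐈 f)) ⟩
    appsᶠ (lift M · f) m xs                      ∎)
    where open βη-Reasoning

  i⇒iii : HasArity m 1 M → M • ∘ 𝐁^ (suc m) =βη (𝐁 · M) ∘ 𝐁
  i⇒iii (N ∷ [] , p) = βη-ext (suc (suc m)) (begin
    appsᶠ (lift (M • ∘ 𝐁^ (suc m))) (suc (suc m)) var ≡⟨ two-heads (M • ∘ 𝐁^ (suc m)) ⟩
    appsᶠ (lift (M • ∘ 𝐁^ (suc m)) · g · y) m zs      ≈⟨ L₃-appsᶠ g y zs ⟩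
    g · appsᶠ (lift M · y) m zs                       ≈⟨ app refl (hasArity⇒appsᶠ p y zs) ⟩
    g · (y · subst zs N)                              ≈⟨ 𝐁-β g y _ ⟨
    𝐁 · g · y · subst zs N                            ≈⟨ hasArity⇒appsᶠ p (𝐁 · g · y) zs ⟨
    appsᶠ (lift M · (𝐁 · g · y)) m zs                 ≈⟨ appsᶠ-congˡ zs (𝐁∘𝐁-β (lift M) g y) ⟨
    appsᶠ (lift ((𝐁 · M) ∘ 𝐁) · g · y) m zs           ≡⟨ two-heads ((𝐁 · M) ∘ 𝐁) ⟨
    appsᶠ (lift ((𝐁 · M) ∘ 𝐁)) (suc (suc m)) var      ∎)
    where
    open βη-Reasoning
    g y : Term (suc (suc m))
    g = var (fromℕ (suc m))
    y = var (inject₁ (fromℕ m))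
    zs : Vector (Term (suc (suc m))) m
    zs = init (init var)
    two-heads : (A : Term 0) → appsᶠ (lift A) (suc (suc m)) var ≡ appsᶠ (lift A · g · y) m zs
    two-heads A = ≡.trans (appsᶠ-init-last (lift A) var) (appsᶠ-init-last (lift A · g) (init var))

proposition2p1 : (M : Term 0) (m : ℕ) →
    (HasArity m 1 M ⇔ ((M · 𝐈) • ∘ 𝐁^ m =βη M))
    × (HasArity m 1 M ⇔ (M • ∘ 𝐁^ (suc m) =βη (𝐁 · M) ∘ 𝐁))
proposition2p1 M m =
  mk⇔ (i⇒ii M m) (ii⇒i M m) ,
  mk⇔ (i⇒iii M m) (λ H → ii⇒i M m (iii⇒ii M m H))
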